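{- Let $p,q$ be positive integers, $n=p+q$, and let $X\cdot Y=C_{p,q}$ be a Boolean decomposition, where $X$ is an $n\times r$ $0,1$-matrix and $Y$ is an $r\times n$ $0,1$-matrix. Let $x_1,\dots,x_r$ be the columns of $X$ and $y_1,\dots,y_r$ the rows of $Y$. Then: (1) for each $i\in[r]$, if $x_i$ has more than $p$ ones then $y_i$ is the all-zero vector, and if $y_i$ has more than $p$ ones then $x_i$ is the all-zero vector; (2) for each $i\in[r]$, if $|x_i|,|y_i|>0$ then $|x_i|+|y_i|\le p+1$; (3) if $q\ge p-1$, then there exist $n$ distinct indices $i_1,\dots,i_n\in[r]$ such that $|x_{i_j}|>0$ and $|y_{i_j}|>0$ for every $j\in[n]$.
   Context: For integers $p\ge 1$, $q\ge 0$ and $n=p+q$, $C_{p,q}$ is the $n\times n$ circulant $0,1$-matrix whose entry in row $i$, column $j$ ($1\le i,j\le n$) is $1$ iff $(i-j) \bmod n \in\{0,1,\dots,p-1\}$. A Boolean decomposition $X\cdot Y=C$ means the product is computed with Boolean arithmetic ($1+1=1$, $1+0=0+1=1$, $0+0=0$, ordinary multiplication of $0,1$). For a $0,1$-vector $x$, $|x|$ denotes the number of ones in $x$. -}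

module Defs where

open import Data.Nat using (ℕ; zero; suc; _+_; _∸_; _<ᵇ_; _%_; NonZero)
open import Data.Bool using (Bool; true; false; _∧_; _∨_; if_then_else_)
open import Data.Fin using (Fin; toℕ)


Mat : ℕ → ℕ → Set
Mat m k = Fin m → Fin k → Bool

bigOr : ∀ {r} → (Fin r → Bool) → Bool
bigOr {zero}  f = false
bigOr {suc r} f = f Fin.zero ∨ bigOr (λ k → f (Fin.suc k))

_⊙_ : ∀ {m r k} → Mat m r → Mat r k → Mat m k
(X ⊙ Y) a b = bigOr (λ t → X a t ∧ Y t b)

ones : ∀ {m} → (Fin m → Bool) → ℕ
ones {zero}  x = 0
ones {suc m} x = (if x Fin.zero then 1 else 0) + ones (λ i → x (Fin.suc i))

-- C_{p,q} (0-indexed; n = p + q): entry (i,j) is 1 iff (i - j) mod n ∈ {0,…,p-1}.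
-- For 0 ≤ i,j < n, (i - j) mod n = (i + n - j) % n.
circ : (p q : ℕ) → .{{NonZero (p + q)}} → Mat (p + q) (p + q)
circ p q i j = ((toℕ i + (p + q) ∸ toℕ j) % (p + q)) <ᵇ p

module Submission where

-- Write n = p + q and δ x y = (x - y) mod n for the circular difference, so
-- that C_{p,q} a b = 1 iff δ a b < p.  In a Boolean decomposition X ⊙ Y = C every
-- rank-one term x_i y_iᵀ lies inside C, i.e. δ a b < p whenever a is in the
-- support A of x_i and b in the support B of y_i.  Everything follows from this:
--
--  * Sumset bound (part 2): if q ≥ 1 and A, B ≠ ∅ with δ a b < p on A × B, then
--    |A| + |B| ≤ p + 1.  Measure offsets u t = δ t z from a fixed z ∈ B and let
--    m ∈ A have the least offset.  The offsets u b (b ∈ B), the shifted offsets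
--    u a + q (a ∈ A) and the gap u m + 1, …, u m + q - 1 are |B| + |A| + q - 1
--    distinct numbers below n, because an offset of B can never lie 1..q above an
--    offset of A (that would force δ a b = n - s ≥ p).
--  * Part 1 is the sumset bound applied to a vector with more than p ones.
--  * Part 3: C is 1 on the diagonal, so each j has an index ι j with
--    X j (ι j) = Y (ι j) j = 1; if ι j = ι k then δ j k, δ k j < p, and when
--    q ≥ p - 1 this forces j = k since δ j k + δ k j ≡ 0 (mod n).

open import Defs
open import Data.Nat using (ℕ; zero; suc; pred; _+_; _∸_; _≤_; _<_; _≥_; _%_; NonZero; z≤n; s≤s; >-nonZero⁻¹)
open import Data.Nat.Properties
open import Data.Nat.DivMod using (m%n%n≡m%n; %-distribˡ-+; [m+n]%n≡m%n; m%n<n; m<n⇒m%n≡m; n%n≡0; m≤n⇒[n∸m]%m≡n%m)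
open import Data.Bool using (Bool; true; false; _∧_; T)
open import Data.Unit using (tt)
open import Data.Empty using (⊥)
open import Data.Fin using (Fin; toℕ; fromℕ<; splitAt; join)
open import Data.Fin.Properties using (toℕ-injective; toℕ-fromℕ<; toℕ<n; injective⇒≤; join-splitAt)
  renaming (suc-injective to Fin-suc-injective)
open import Data.Vec.Functional using (_++_)
open import Data.Product using (_×_; Σ; ∃; _,_; proj₁; proj₂)
open import Data.Sum using (_⊎_; inj₁; inj₂; [_,_]′)
open import Function using (Injective; _∘_)
open import Relation.Nullary using (yes; no; contradiction)
open import Relation.Binary.PropositionalEquality

ones-pos : ∀ {m} (x : Fin m → Bool) t → x t ≡ true → 0 < ones x
ones-pos x Fin.zero xt rewrite xt = s≤s z≤n
ones-pos {suc _} x (Fin.suc t) xt = ≤-trans (ones-pos (x ∘ Fin.suc) t xt) (m≤n+m _ _)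

ones-witness : ∀ {m} (x : Fin m → Bool) → 0 < ones x → ∃ λ t → x t ≡ true
ones-witness {suc _} x pos with x Fin.zero in x0
... | true  = Fin.zero , x0
... | false with ones-witness (x ∘ Fin.suc) pos
...   | t , xt = Fin.suc t , xt

∧-true : ∀ {x y} → x ∧ y ≡ true → x ≡ true × y ≡ true
∧-true {true} {true} _ = refl , refl

bigOr-intro : ∀ {r} (f : Fin r → Bool) t → f t ≡ true → bigOr f ≡ true
bigOr-intro f Fin.zero ft rewrite ft = refl
bigOr-intro f (Fin.suc t) ft with f Fin.zero
... | true  = refl
... | false = bigOr-intro (f ∘ Fin.suc) t ft

bigOr-witness : ∀ {r} (f : Fin r → Bool) → bigOr f ≡ true → ∃ λ t → f t ≡ true
bigOr-witness {suc _} f or with f Fin.zero in f0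
... | true  = Fin.zero , f0
... | false with bigOr-witness (f ∘ Fin.suc) or
...   | t , ft = Fin.suc t , ft

record Enumeration {m} (x : Fin m → Bool) (K : ℕ) : Set where
  field
    index      : Fin K → Fin m
    injective  : Injective _≡_ _≡_ index
    in-support : ∀ k → x (index k) ≡ true

enumerate : ∀ {m} (x : Fin m → Bool) → Enumeration x (ones x)
enumerate {zero} x = record { index = λ () ; injective = λ {} ; in-support = λ () }
enumerate {suc m} x with x Fin.zero in x0
... | true  = record { index = index′ ; injective = injective′ ; in-support = in-support′ }
  where
  open Enumeration (enumerate (x ∘ Fin.suc))
  index′ : Fin (suc (ones (x ∘ Fin.suc))) → Fin (suc m)
  index′ Fin.zero    = Fin.zero
  index′ (Fin.suc k) = Fin.suc (index k)
  injective′ : Injective _≡_ _≡_ index′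
  injective′ {Fin.zero}  {Fin.zero}  _  = refl
  injective′ {Fin.suc k} {Fin.suc l} eq = cong Fin.suc (injective (Fin-suc-injective eq))
  in-support′ : ∀ k → x (index′ k) ≡ true
  in-support′ Fin.zero    = x0
  in-support′ (Fin.suc k) = in-support k
... | false = record { index = Fin.suc ∘ index
                     ; injective = injective ∘ Fin-suc-injective
                     ; in-support = in-support }
  where open Enumeration (enumerate (x ∘ Fin.suc))

Least : ∀ {m} (x : Fin m → Bool) (g : Fin m → ℕ) → Set
Least x g = ∃ λ t → x t ≡ true × (∀ u → x u ≡ true → g t ≤ g u)

least-or-empty : ∀ {m} (x : Fin m → Bool) (g : Fin m → ℕ) → Least x g ⊎ (∀ u → x u ≡ false)
least-or-empty {zero} x g = inj₂ λ ()
least-or-empty {suc _} x g with x Fin.zero in x0 | least-or-empty (x ∘ Fin.suc) (g ∘ Fin.suc)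
... | false | inj₂ none = inj₂ λ { Fin.zero → x0 ; (Fin.suc u) → none u }
... | false | inj₁ (t , xt , least) =
  inj₁ (Fin.suc t , xt , λ { Fin.zero xu → contradiction (trans (sym x0) xu) λ ()
                           ; (Fin.suc u) xu → least u xu })
... | true | inj₂ none =
  inj₁ (Fin.zero , x0 , λ { Fin.zero _ → ≤-refl
                          ; (Fin.suc u) xu → contradiction (trans (sym (none u)) xu) λ () })
... | true | inj₁ (t , xt , least) with g Fin.zero ≤? g (Fin.suc t)
...   | yes g0≤ = inj₁ (Fin.zero , x0 , λ { Fin.zero _ → ≤-refl ; (Fin.suc u) xu → ≤-trans g0≤ (least u xu) })
...   | no  g0≰ = inj₁ (Fin.suc t , xt , λ { Fin.zero _ → <⇒≤ (≰⇒> g0≰) ; (Fin.suc u) xu → least u xu })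

least : ∀ {m} (x : Fin m → Bool) (g : Fin m → ℕ) t → x t ≡ true → Least x g
least x g t xt with least-or-empty x g
... | inj₁ l    = l
... | inj₂ none = contradiction (trans (sym (none t)) xt) λ ()

record Distinct (K N : ℕ) : Set where
  field
    elem      : Fin K → ℕ
    below     : ∀ k → elem k < N
    injective : Injective _≡_ _≡_ elem
open Distinct

Disjoint : ∀ {a b N} → Distinct a N → Distinct b N → Set
Disjoint F G = ∀ x y → elem F x ≢ elem G y

size≤ : ∀ {K N} → Distinct K N → K ≤ N
size≤ F = injective⇒≤ {f = λ k → fromℕ< (below F k)} λ {x} {y} eq →
  injective F (begin
    elem F x                  ≡⟨ toℕ-fromℕ< (below F x) ⟨
    toℕ (fromℕ< (below F x))  ≡⟨ cong toℕ eq ⟩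
    toℕ (fromℕ< (below F y))  ≡⟨ toℕ-fromℕ< (below F y) ⟩
    elem F y                  ∎)
  where open ≡-Reasoning

union : ∀ {a b N} (F : Distinct a N) (G : Distinct b N) → Disjoint F G → Distinct (a + b) N
union {a} {b} {N} F G disj = record
  { elem = elem F ++ elem G
  ; below = below′
  ; injective = λ {x} {y} eq →
      trans (sym (join-splitAt a b x))
            (trans (cong (join a b) (sum-injective (splitAt a x) (splitAt a y) eq)) (join-splitAt a b y))
  }
  where
  below′ : ∀ k → (elem F ++ elem G) k < N
  below′ k with splitAt a k
  ... | inj₁ x = below F x
  ... | inj₂ y = below G y
  sum-injective : ∀ u v → [ elem F , elem G ]′ u ≡ [ elem F , elem G ]′ v → u ≡ v
  sum-injective (inj₁ x) (inj₁ y) eq = cong inj₁ (injective F eq)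
  sum-injective (inj₁ x) (inj₂ y) eq = contradiction eq (disj x y)
  sum-injective (inj₂ x) (inj₁ y) eq = contradiction (sym eq) (disj y x)
  sum-injective (inj₂ x) (inj₂ y) eq = cong inj₂ (injective G eq)

union-disjoint : ∀ {a b c N} (F : Distinct a N) (G : Distinct b N) (H : Distinct c N) (disj : Disjoint F G)
  → Disjoint F H → Disjoint G H → Disjoint (union F G disj) H
union-disjoint {a} F G H disj FH GH x y with splitAt a x
... | inj₁ x′ = FH x′ y
... | inj₂ x′ = GH x′ y

module Circular (n : ℕ) .{{_ : NonZero n}} where
  open ≡-Reasoning

  infix 4 _≈_
  _≈_ : ℕ → ℕ → Set
  x ≈ y = x % n ≡ y % n

  %-≈ : ∀ x → x % n ≈ x
  %-≈ x = m%n%n≡m%n x n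

  +-≈ : ∀ {x x′ y y′} → x ≈ x′ → y ≈ y′ → x + y ≈ x′ + y′
  +-≈ {x} {x′} {y} {y′} x≈ y≈ = begin
    (x + y) % n              ≡⟨ %-distribˡ-+ x y n ⟩
    (x % n + y % n) % n      ≡⟨ cong₂ (λ u v → (u + v) % n) x≈ y≈ ⟩
    (x′ % n + y′ % n) % n    ≡⟨ %-distribˡ-+ x′ y′ n ⟨
    (x′ + y′) % n            ∎

  complement-≈ : ∀ x a → x + a + (n ∸ a % n) ≈ x
  complement-≈ x a = begin
    (x + a + (n ∸ a % n)) % n        ≡⟨ +-≈ (+-≈ {x} refl (sym (%-≈ a))) refl ⟩
    (x + a % n + (n ∸ a % n)) % n    ≡⟨ cong (_% n) (+-assoc x (a % n) _) ⟩
    (x + (a % n + (n ∸ a % n))) % n  ≡⟨ cong (λ v → (x + v) % n) (m+[n∸m]≡n (<⇒≤ (m%n<n a n))) ⟩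
    (x + n) % n                      ≡⟨ [m+n]%n≡m%n x n ⟩
    x % n                            ∎

  +-cancelʳ-≈ : ∀ {x y} a → x + a ≈ y + a → x ≈ y
  +-cancelʳ-≈ {x} {y} a eq = begin
    x % n                        ≡⟨ complement-≈ x a ⟨
    (x + a + (n ∸ a % n)) % n    ≡⟨ +-≈ eq refl ⟩
    (y + a + (n ∸ a % n)) % n    ≡⟨ complement-≈ y a ⟩
    y % n                        ∎

  ≈⇒≡ : ∀ {x y} → x < n → y < n → x ≈ y → x ≡ y
  ≈⇒≡ x<n y<n eq = trans (sym (m<n⇒m%n≡m x<n)) (trans eq (m<n⇒m%n≡m y<n))

  ≈0⇒≡n : ∀ {x} → 0 < x → x < n + n → x ≈ 0 → x ≡ n
  ≈0⇒≡n {x} pos x<2n x≈0 with x <? n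
  ... | yes x<n = contradiction (≈⇒≡ x<n (>-nonZero⁻¹ n) x≈0) (>⇒≢ pos)
  ... | no  x≮n = begin
    x          ≡⟨ m∸n+n≡m n≤x ⟨
    x ∸ n + n  ≡⟨ cong (_+ n) x∸n≡0 ⟩
    n          ∎
    where
    n≤x : n ≤ x
    n≤x = ≮⇒≥ x≮n
    x∸n≡0 : x ∸ n ≡ 0
    x∸n≡0 = ≈⇒≡ (m<n+o⇒m∸n<o x n x<2n) (>-nonZero⁻¹ n) (trans (m≤n⇒[n∸m]%m≡n%m n≤x) x≈0)

  δ : ℕ → ℕ → ℕ
  δ x y = (x + n ∸ y) % n

  δ<n : ∀ x y → δ x y < n
  δ<n x y = m%n<n (x + n ∸ y) n

  δ+-≈ : ∀ x {y} → y < n → δ x y + y ≈ x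
  δ+-≈ x {y} y<n = begin
    (δ x y + y) % n        ≡⟨ +-≈ (%-≈ (x + n ∸ y)) refl ⟩
    (x + n ∸ y + y) % n    ≡⟨ cong (_% n) (m∸n+n≡m (≤-trans (<⇒≤ y<n) (m≤n+m n x))) ⟩
    (x + n) % n            ≡⟨ [m+n]%n≡m%n x n ⟩
    x % n                  ∎

  δ-self : ∀ x → δ x x ≡ 0
  δ-self x = trans (cong (_% n) (m+n∸m≡n x n)) (n%n≡0 n)

  δ-injectiveˡ : ∀ {x y z} → x < n → y < n → z < n → δ x z ≡ δ y z → x ≡ y
  δ-injectiveˡ {x} {y} {z} x<n y<n z<n eq = ≈⇒≡ x<n y<n (begin
    x % n            ≡⟨ δ+-≈ x z<n ⟨
    (δ x z + z) % n  ≡⟨ cong (λ v → (v + z) % n) eq ⟩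
    (δ y z + z) % n  ≡⟨ δ+-≈ y z<n ⟩
    y % n            ∎)

  δ-cocycle : ∀ x {y z} → y < n → z < n → δ x y + δ y z ≈ δ x z
  δ-cocycle x {y} {z} y<n z<n = +-cancelʳ-≈ z (begin
    (δ x y + δ y z + z) % n    ≡⟨ cong (_% n) (+-assoc (δ x y) (δ y z) z) ⟩
    (δ x y + (δ y z + z)) % n  ≡⟨ +-≈ {δ x y} refl (δ+-≈ y z<n) ⟩
    (δ x y + y) % n            ≡⟨ δ+-≈ x y<n ⟩
    x % n                      ≡⟨ δ+-≈ x z<n ⟨
    (δ x z + z) % n            ∎)

  δ-wrap : ∀ a {b z s} → b < n → z < n → δ b z ≡ δ a z + s → 0 < s → s ≤ n → δ a b + s ≡ n
  δ-wrap a {b} {z} {s} b<n z<n shift pos s≤n =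
    ≈0⇒≡n (≤-trans pos (m≤n+m s (δ a b))) (+-mono-<-≤ (δ<n a b) s≤n) (+-cancelʳ-≈ (δ a z) (begin
      (δ a b + s + δ a z) % n    ≡⟨ cong (_% n) (+-assoc (δ a b) s (δ a z)) ⟩
      (δ a b + (s + δ a z)) % n  ≡⟨ cong (λ v → (δ a b + v) % n) (trans (+-comm s (δ a z)) (sym shift)) ⟩
      (δ a b + δ b z) % n        ≡⟨ δ-cocycle a b<n z<n ⟩
      δ a z % n                  ∎))

  δ-antisym : ∀ {x y} → x < n → y < n → δ x y + δ y x < n → x ≡ y
  δ-antisym {x} {y} x<n y<n small = δ-injectiveˡ x<n y<n y<n (trans δxy≡0 (sym (δ-self y)))
    where
    sum≈0 : δ x y + δ y x ≈ 0
    sum≈0 = trans (δ-cocycle x y<n x<n) (cong (_% n) (δ-self x))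
    δxy≡0 : δ x y ≡ 0
    δxy≡0 = m+n≡0⇒m≡0 (δ x y) (≈⇒≡ small (>-nonZero⁻¹ n) sum≈0)

cancel-pred : ∀ {k p q} → 1 ≤ q → k + pred q ≤ p + q → k ≤ suc p
cancel-pred {k} {p} {suc q} _ le = +-cancelʳ-≤ q k (suc p) (subst (k + q ≤_) (+-suc p q) le)

module Window (p q : ℕ) .{{_ : NonZero (p + q)}} where
  open Circular (p + q) public

  module _ (q≥1 : 1 ≤ q) (A B : Fin (p + q) → Bool)
           (window : ∀ a b → A a ≡ true → B b ≡ true → δ (toℕ a) (toℕ b) < p) where

    module Offsets {z : Fin (p + q)} (z∈B : B z ≡ true) where

      u : Fin (p + q) → ℕ
      u t = δ (toℕ t) (toℕ z)

      u-injective : Injective _≡_ _≡_ u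
      u-injective {s} {t} eq = toℕ-injective (δ-injectiveˡ (toℕ<n s) (toℕ<n t) (toℕ<n z) eq)

      u<p : ∀ a → A a ≡ true → u a < p
      u<p a a∈A = window a z a∈A z∈B

      no-gap : ∀ {a b s} → A a ≡ true → B b ≡ true → u b ≡ u a + s → 0 < s → s ≤ q → ⊥
      no-gap {a} {b} a∈A b∈B shift pos s≤q = <⇒≢ (+-mono-<-≤ (window a b a∈A b∈B) s≤q)
        (δ-wrap (toℕ a) (toℕ<n b) (toℕ<n z) shift pos (≤-trans s≤q (m≤n+m q p)))

      module EA = Enumeration (enumerate A)
      module EB = Enumeration (enumerate B)

      offsetsB : Distinct (ones B) (p + q)
      offsetsB = record
        { elem = u ∘ EB.index
        ; below = λ k → δ<n (toℕ (EB.index k)) (toℕ z)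
        ; injective = EB.injective ∘ u-injective }

      shiftedA : Distinct (ones A) (p + q)
      shiftedA = record
        { elem = λ k → u (EA.index k) + q
        ; below = λ k → +-monoˡ-< q (u<p _ (EA.in-support k))
        ; injective = λ eq → EA.injective (u-injective (+-cancelʳ-≡ q _ _ eq)) }

      A-B-disjoint : Disjoint shiftedA offsetsB
      A-B-disjoint k l eq = no-gap (EA.in-support k) (EB.in-support l) (sym eq) q≥1 ≤-refl

      module Gap {m : Fin (p + q)} (m∈A : A m ≡ true) (m-least : ∀ a → A a ≡ true → u m ≤ u a) where

        gap : Distinct (pred q) (p + q)
        gap = record
          { elem = λ k → u m + suc (toℕ k)
          ; below = λ k → +-mono-<-≤ (u<p m m∈A) (<⇒≤ (pred-cancel-< (toℕ<n k)))
          ; injective = λ eq → toℕ-injective (suc-injective (+-cancelˡ-≡ (u m) _ _ eq)) }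

        -- The shifted offsets are at least u m + q, above the whole gap.
        A-gap-disjoint : Disjoint shiftedA gap
        A-gap-disjoint k l eq =
          <⇒≢ (+-mono-≤-< (m-least _ (EA.in-support k)) (pred-cancel-< (toℕ<n l))) (sym eq)

        -- An offset of B inside the gap would lie 1..q-1 above u m.
        B-gap-disjoint : Disjoint offsetsB gap
        B-gap-disjoint k l eq =
          no-gap m∈A (EB.in-support k) eq (s≤s z≤n) (<⇒≤ (pred-cancel-< (toℕ<n l)))

        packing : Distinct (ones A + ones B + pred q) (p + q)
        packing = union (union shiftedA offsetsB A-B-disjoint) gap
          (union-disjoint shiftedA offsetsB gap A-B-disjoint A-gap-disjoint B-gap-disjoint)

    sumset-bound : 0 < ones A → 0 < ones B → ones A + ones B ≤ suc p
    sumset-bound A≠∅ B≠∅ with ones-witness B B≠∅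
    ... | z , z∈B with ones-witness A A≠∅
    ...   | a , a∈A with least A (Offsets.u z∈B) a a∈A
    ...     | m , m∈A , m-least = cancel-pred q≥1 (size≤ (Offsets.Gap.packing z∈B m∈A m-least))

overfull⇒empty : ∀ {p k l} (x : Fin k → Bool) (y : Fin l → Bool)
  → (0 < ones x → 0 < ones y → ones x + ones y ≤ suc p) → p < ones x → ∀ b → y b ≡ false
overfull⇒empty {p} x y bound p<x b with y b in yb
... | false = refl
... | true  = contradiction (bound (≤-trans (s≤s z≤n) p<x) y≠0) (<⇒≱ too-many)
  where
  y≠0 : 0 < ones y
  y≠0 = ones-pos y b yb
  too-many : suc p < ones x + ones y
  too-many = subst (suc p <_) (+-comm (ones y) (ones x)) (+-mono-≤ y≠0 p<x)

module Decomposition (p q r : ℕ) .{{_ : NonZero (p + q)}}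
                     (X : Mat (p + q) r) (Y : Mat r (p + q))
                     (X⊙Y≡C : ∀ a b → (X ⊙ Y) a b ≡ circ p q a b) where
  open Window p q

  column : Fin r → Fin (p + q) → Bool
  column i a = X a i

  row : Fin r → Fin (p + q) → Bool
  row i b = Y i b

  rank-one-inside : ∀ i a b → X a i ≡ true → Y i b ≡ true → δ (toℕ a) (toℕ b) < p
  rank-one-inside i a b Xai Yib = <ᵇ⇒< (δ (toℕ a) (toℕ b)) p (subst T (sym Cab) tt)
    where
    Cab : circ p q a b ≡ true
    Cab = trans (sym (X⊙Y≡C a b)) (bigOr-intro (λ t → X a t ∧ Y t b) i (cong₂ _∧_ Xai Yib))

  support-bound : 1 ≤ q → ∀ i → 0 < ones (column i) → 0 < ones (row i)
    → ones (column i) + ones (row i) ≤ suc p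
  support-bound q≥1 i = sumset-bound q≥1 (column i) (row i) (rank-one-inside i)

  circ-diagonal : 1 ≤ p → ∀ j → circ p q j j ≡ true
  circ-diagonal (s≤s _) j rewrite δ-self (toℕ j) = refl

  diagonal-cover : 1 ≤ p → ∀ j → ∃ λ i → X j i ≡ true × Y i j ≡ true
  diagonal-cover p≥1 j with bigOr-witness (λ t → X j t ∧ Y t j) (trans (X⊙Y≡C j j) (circ-diagonal p≥1 j))
  ... | i , Xji∧Yij = i , ∧-true Xji∧Yij

  overfull-empty : 1 ≤ q → ∀ i → (p < ones (column i) → ∀ b → Y i b ≡ false)
                                × (p < ones (row i) → ∀ a → X a i ≡ false)
  overfull-empty q≥1 i =
      overfull⇒empty (column i) (row i) (support-bound q≥1 i)
    , overfull⇒empty (row i) (column i) λ y≠0 x≠0 →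
        subst (_≤ suc p) (+-comm (ones (column i)) (ones (row i))) (support-bound q≥1 i x≠0 y≠0)

  distinct-covers : 1 ≤ p → q ≥ pred p → Σ (Fin (p + q) → Fin r) λ ι → Injective _≡_ _≡_ ι
                      × (∀ j → (0 < ones (column (ι j))) × (0 < ones (row (ι j))))
  distinct-covers p≥1 q≥p-1 = ι , ι-injective , λ j → ones-pos (column (ι j)) j (X-ι j) , ones-pos (row (ι j)) j (Y-ι j)
    where
    ι : Fin (p + q) → Fin r
    ι j = proj₁ (diagonal-cover p≥1 j)
    X-ι : ∀ j → X j (ι j) ≡ true
    X-ι j = proj₁ (proj₂ (diagonal-cover p≥1 j))
    Y-ι : ∀ j → Y (ι j) j ≡ true
    Y-ι j = proj₂ (proj₂ (diagonal-cover p≥1 j))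
    -- if ι j = ι k the term ι j contains both (j, k) and (k, j), so δ j k, δ k j < p
    ι-injective : Injective _≡_ _≡_ ι
    ι-injective {j} {k} ιj≡ιk = toℕ-injective (δ-antisym (toℕ<n j) (toℕ<n k)
      (+-mono-<-≤ (rank-one-inside (ι j) j k (X-ι j) Y-ι-jk)
                  (≤-trans (<⇒≤pred (rank-one-inside (ι j) k j X-ι-jk (Y-ι j))) q≥p-1)))
      where
      Y-ι-jk : Y (ι j) k ≡ true
      Y-ι-jk = subst (λ i → Y i k ≡ true) (sym ιj≡ιk) (Y-ι k)
      X-ι-jk : X k (ι j) ≡ true
      X-ι-jk = subst (λ i → X k i ≡ true) (sym ιj≡ιk) (X-ι k)

mainTheorem7 : (p q r : ℕ) → 1 ≤ p → 1 ≤ q → .{{_ : NonZero (p + q)}}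
    → (X : Mat (p + q) r) → (Y : Mat r (p + q)) → (∀ a b → (X ⊙ Y) a b ≡ circ p q a b)
    → ((i : Fin r) → (p < ones (λ a → X a i) → (b : Fin (p + q)) → Y i b ≡ false)
                   × (p < ones (λ b → Y i b) → (a : Fin (p + q)) → X a i ≡ false))
      × ((i : Fin r) → 0 < ones (λ a → X a i) → 0 < ones (λ b → Y i b)
                     → ones (λ a → X a i) + ones (λ b → Y i b) ≤ suc p)
      × (q ≥ p ∸ 1 → Σ (Fin (p + q) → Fin r) λ ι → Injective _≡_ _≡_ ι
                     × ((j : Fin (p + q)) → (0 < ones (λ a → X a (ι j))) × (0 < ones (λ b → Y (ι j) b))))
mainTheorem7 p q r p≥1 q≥1 X Y X⊙Y≡C =
  overfull-empty q≥1 , support-bound q≥1 , distinct-covers p≥1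
  where open Decomposition p q r X Y X⊙Y≡C
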